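{- Let $\Pi$ be the map on $\mathbb{N}=\{1,2,3,\dots\}$ produced by the following procedure. At step $1$ set $\Pi(1)=1$. For $m=2,3,4,\dots$ in turn, at step $m$: if $\Pi(m-\lfloor m/2\rfloor)$ has not been assigned at an earlier step, set $\Pi(m-\lfloor m/2\rfloor)=m$; otherwise set $\Pi(m+\lfloor m/2\rfloor)=m$. Let $E:\mathbb{N}\to\mathbb{N}$ be defined by $E(3n+1)=9n+1$, $E(3n+2)=9n+4$, $E(3n+3)=9n+6$ for $n\ge0$. Then $\Pi(E(n))=3\Pi(n)-2$ for all $n\ge1$.
   Context: The procedure assigns a value $\Pi(n)$ to every $n\in\mathbb{N}$. -}

module Defs where

open import Data.Nat using (ℕ; zero; suc; _+_; _*_; _∸_; _/_; _%_; _≤_; _<_; _≟_)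
open import Data.List using (List; []; _∷_)
open import Data.List.Relation.Unary.Any using (any?)
open import Data.Product using (_×_)
open import Relation.Nullary using (yes; no; ¬_)
open import Relation.Binary.PropositionalEquality using (_≡_)

choose : ℕ → List ℕ → ℕ
choose m used with any? (λ q → (m ∸ m / 2) ≟ q) used
... | yes _ = m + m / 2
... | no  _ = m ∸ m / 2

hist : ℕ → List ℕ
hist zero = []
hist (suc zero) = 1 ∷ []
hist (suc (suc k)) = choose (suc (suc k)) (hist (suc k)) ∷ hist (suc k)

pos : ℕ → ℕ
pos zero = 0
pos (suc zero) = 1
pos (suc (suc k)) = choose (suc (suc k)) (hist (suc k))

-- Π p ≡ m, as a relation: step m (m ≥ 1) set Π(p) = m and no later
-- step ever set Π(p) again (so m is the final value of Π at p).
ΠIs : ℕ → ℕ → Set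
ΠIs p m = (1 ≤ m) × (pos m ≡ p) × (∀ k → m < k → ¬ (pos k ≡ p))

E : ℕ → ℕ
E zero = 0
E (suc k) with k % 3
... | 0 = 9 * (k / 3) + 1
... | 1 = 9 * (k / 3) + 4
... | _ = 9 * (k / 3) + 6

-- Since every position is assigned at most once, Π(p) = m
-- just says that step m lands on p, and the claim becomes: step 3m - 2
-- lands on E(position of step m).  An even step 2k always lands on 3k,
-- because its target k was taken at the latest by step 2k - 1.  This
-- settles even m.  For m = 2i + 1, the target of step 6i + 1 is 3i + 1,
-- which only steps 2i + 1 (landing high) and 6i + 1, 6i + 2 (landing low)
-- can reach.  So step 6i + 1 lands high on 9i + 1 exactly when step
-- 2i + 1 landed high on 3i + 1, and low on 3i + 1 exactly when step
-- 2i + 1 landed low on i + 1; in the latter case i + 1 is not a multiple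
-- of 3, as step 2(i+1)/3 would have taken it.
module Submission where

open import Defs
open import Data.Nat using (ℕ; zero; suc; _+_; _*_; _∸_; _/_; _%_; _≤_; _<_; _≟_; z≤n; s≤s; s≤s⁻¹; NonZero)
open import Data.Nat.Properties
open import Data.Nat.DivMod
open import Data.Nat.Divisibility using (_∣_; divides)
open import Data.Nat.Tactic.RingSolver using (solve-∀)
open import Data.Fin using (zero; suc)
open import Data.List using (List)
open import Data.List.Membership.Propositional using (_∈_; _∉_)
open import Data.List.Membership.DecPropositional _≟_ using (_∈?_)
open import Data.List.Relation.Unary.Any using (here; there; any?)
open import Data.Product using (∃-syntax; _×_; _,_)
open import Data.Sum using (_⊎_; inj₁; inj₂; [_,_]′)
open import Function using (_∘_)
open import Relation.Nullary using (yes; no; ¬_; Dec; contradiction)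
open import Relation.Nullary.Decidable using (map′)
open import Relation.Binary.PropositionalEquality
open ≡-Reasoning

[r+q*n]/n≡q : ∀ r q n .{{_ : NonZero n}} → r < n → (r + q * n) / n ≡ q
[r+q*n]/n≡q r q n r<n = begin
  (r + q * n) / n    ≡⟨ +-distrib-/ r (q * n) remainders<n ⟩
  r / n + q * n / n  ≡⟨ cong₂ _+_ (m<n⇒m/n≡0 r<n) (m*n/n≡m q n) ⟩
  q                  ∎
  where
  remainders<n : r % n + (q * n) % n < n
  remainders<n = subst (_< n) (sym (trans (cong₂ _+_ (m<n⇒m%n≡m r<n) (m*n%n≡0 q n)) (+-identityʳ r))) r<n

[r+q*n]%n≡r : ∀ r q n .{{_ : NonZero n}} → r < n → (r + q * n) % n ≡ r
[r+q*n]%n≡r r q n r<n = trans ([m+kn]%n≡m%n r q n) (m<n⇒m%n≡m r<n)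

half-even : ∀ c → c * 2 / 2 ≡ c
half-even c = m*n/n≡m c 2

half-odd : ∀ c → (1 + c * 2) / 2 ≡ c
half-odd c = [r+q*n]/n≡q 1 c 2 (s≤s (s≤s z≤n))

down up : ℕ → ℕ
down m = m ∸ m / 2
up m = m + m / 2

down-even : ∀ c → down (c * 2) ≡ c
down-even c = begin
  c * 2 ∸ c * 2 / 2  ≡⟨ cong₂ _∸_ (double c) (half-even c) ⟩
  c + c ∸ c          ≡⟨ m+n∸n≡m c c ⟩
  c                  ∎
  where
  double : ∀ c → c * 2 ≡ c + c
  double = solve-∀

down-odd : ∀ c → down (1 + c * 2) ≡ suc c
down-odd c = begin
  1 + c * 2 ∸ (1 + c * 2) / 2  ≡⟨ cong₂ _∸_ (double+1 c) (half-odd c) ⟩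
  suc c + c ∸ c                ≡⟨ m+n∸n≡m (suc c) c ⟩
  suc c                        ∎
  where
  double+1 : ∀ c → 1 + c * 2 ≡ suc c + c
  double+1 = solve-∀

up-even : ∀ c → up (c * 2) ≡ c * 3
up-even c = trans (cong (c * 2 +_) (half-even c)) (triple c)
  where
  triple : ∀ c → c * 2 + c ≡ c * 3
  triple = solve-∀

up-odd : ∀ c → up (1 + c * 2) ≡ 1 + c * 3
up-odd c = trans (cong (1 + c * 2 +_) (half-odd c)) (triple+1 c)
  where
  triple+1 : ∀ c → 1 + c * 2 + c ≡ 1 + c * 3
  triple+1 = solve-∀

E[1+q*3]≡9q+1 : ∀ q → E (suc (q * 3)) ≡ 9 * q + 1
E[1+q*3]≡9q+1 q rewrite [r+q*n]%n≡r 0 q 3 (s≤s z≤n) | [r+q*n]/n≡q 0 q 3 (s≤s z≤n) = refl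

E[2+q*3]≡9q+4 : ∀ q → E (suc (1 + q * 3)) ≡ 9 * q + 4
E[2+q*3]≡9q+4 q rewrite [r+q*n]%n≡r 1 q 3 (s≤s (s≤s z≤n)) | [r+q*n]/n≡q 1 q 3 (s≤s (s≤s z≤n)) = refl

E[3+q*3]≡9q+6 : ∀ q → E (suc (2 + q * 3)) ≡ 9 * q + 6
E[3+q*3]≡9q+6 q rewrite [r+q*n]%n≡r 2 q 3 (s≤s (s≤s (s≤s z≤n))) | [r+q*n]/n≡q 2 q 3 (s≤s (s≤s (s≤s z≤n))) = refl

E[1+i]≡1+i*3 : ∀ i → ¬ 3 ∣ suc i → E (suc i) ≡ suc (i * 3)
E[1+i]≡1+i*3 i 3∤1+i with i divMod 3
... | result q zero refl = trans (E[1+q*3]≡9q+1 q) (ring q)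
  where
  ring : ∀ q → 9 * q + 1 ≡ suc (q * 3 * 3)
  ring = solve-∀
... | result q (suc zero) refl = trans (E[2+q*3]≡9q+4 q) (ring q)
  where
  ring : ∀ q → 9 * q + 4 ≡ suc ((1 + q * 3) * 3)
  ring = solve-∀
... | result q (suc (suc zero)) refl = contradiction (divides (suc q) refl) 3∤1+i

choose-∈ : ∀ m (used : List ℕ) → down m ∈ used → choose m used ≡ up m
choose-∈ m used taken with any? (λ q → down m ≟ q) used
... | yes _ = refl
... | no free = contradiction taken free

choose-∉ : ∀ m (used : List ℕ) → down m ∉ used → choose m used ≡ down m
choose-∉ m used free with any? (λ q → down m ≟ q) used
... | yes taken = contradiction taken free
... | no _ = refl

TakenBefore : ℕ → ℕ → Set
TakenBefore m t = ∃[ j ] 1 ≤ j × j < m × pos j ≡ t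

TakenBefore-mono : ∀ {m n t} → m ≤ n → TakenBefore m t → TakenBefore n t
TakenBefore-mono m≤n (j , 1≤j , j<m , pos-j) = j , 1≤j , <-≤-trans j<m m≤n , pos-j

¬TakenBefore-1 : ∀ {t} → ¬ TakenBefore 1 t
¬TakenBefore-1 (j , 1≤j , j<1 , _) = <⇒≱ j<1 1≤j

pos∈hist : ∀ {j} k → 1 ≤ j → j ≤ k → pos j ∈ hist k
pos∈hist (suc zero) (s≤s z≤n) (s≤s z≤n) = here refl
pos∈hist (suc (suc k)) 1≤j j≤k+2 = [ there ∘ pos∈hist (suc k) 1≤j ∘ s≤s⁻¹ , here ∘ cong pos ]′
  (m≤n⇒m<n∨m≡n j≤k+2)

∈hist⇒TakenBefore : ∀ {k t} → t ∈ hist k → TakenBefore (suc k) t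
∈hist⇒TakenBefore {suc zero} (here refl) = 1 , ≤-refl , ≤-refl , refl
∈hist⇒TakenBefore {suc (suc k)} (here refl) = suc (suc k) , s≤s z≤n , ≤-refl , refl
∈hist⇒TakenBefore {suc (suc k)} (there t∈hist) = TakenBefore-mono (n≤1+n _) (∈hist⇒TakenBefore t∈hist)

TakenBefore⇒∈hist : ∀ {k t} → TakenBefore (suc k) t → t ∈ hist k
TakenBefore⇒∈hist (j , 1≤j , j<k+1 , refl) = pos∈hist _ 1≤j (s≤s⁻¹ j<k+1)

takenBefore? : ∀ m t → Dec (TakenBefore m t)
takenBefore? zero t = no λ ()
takenBefore? (suc k) t = map′ ∈hist⇒TakenBefore TakenBefore⇒∈hist (t ∈? hist k)

pos-taken : ∀ {m t} → down m ≡ t → TakenBefore m t → pos m ≡ up m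
pos-taken {suc zero} _ taken = contradiction taken ¬TakenBefore-1
pos-taken {suc (suc k)} refl taken = choose-∈ _ _ (TakenBefore⇒∈hist taken)

pos-free : ∀ {m t} → down m ≡ t → ¬ TakenBefore m t → pos m ≡ t
pos-free {zero} refl _ = refl
pos-free {suc zero} refl _ = refl
pos-free {suc (suc k)} refl free = choose-∉ _ _ (free ∘ ∈hist⇒TakenBefore)

pos-down⊎up : ∀ m → pos m ≡ down m ⊎ pos m ≡ up m
pos-down⊎up m with takenBefore? m (down m)
... | yes taken = inj₂ (pos-taken refl taken)
... | no free = inj₁ (pos-free refl free)

pos≤up : ∀ m → pos m ≤ up m
pos≤up m with pos-down⊎up m
... | inj₁ eq = ≤-trans (≤-reflexive eq) (≤-trans (m∸n≤m m (m / 2)) (m≤m+n m (m / 2)))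
... | inj₂ eq = ≤-reflexive eq

up-mono-< : ∀ {a b} → a < b → up a < up b
up-mono-< a<b = +-mono-<-≤ a<b (/-monoˡ-≤ 2 (<⇒≤ a<b))

-- A step that lands low finds its target free, one that lands high lands
-- beyond every earlier position.
pos-injective : ∀ {a b} → 1 ≤ a → a < b → pos a ≢ pos b
pos-injective {a} {b} 1≤a a<b pa≡pb with takenBefore? b (down b)
... | yes taken = <⇒≢ (≤-<-trans (pos≤up a) (up-mono-< a<b))
                      (trans pa≡pb (pos-taken refl taken))
... | no free = free (a , 1≤a , a<b , trans pa≡pb (pos-free refl free))

pos-even : ∀ k → pos (suc k * 2) ≡ suc k * 3
pos-even k = trans (pos-taken (down-even (suc k)) k+1-taken) (up-even (suc k))
  where
  k+1-taken : TakenBefore (suc k * 2) (suc k)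
  k+1-taken with takenBefore? (1 + k * 2) (suc k)
  ... | yes taken = TakenBefore-mono (n≤1+n _) taken
  ... | no free = 1 + k * 2 , s≤s z≤n , ≤-refl , pos-free (down-odd k) free

pos-preimage-1+i*3 : ∀ {i} j → pos j ≡ suc (i * 3) → j ≡ 1 + i * 2 ⊎ 1 + i * 3 * 2 ≤ j
pos-preimage-1+i*3 {i} j eq with j divMod 2 | pos-down⊎up j
... | result c zero refl | inj₁ low = inj₂ (subst (1 + i * 3 * 2 ≤_) (cong (_* 2) (sym c≡1+i*3)) (n≤1+n _))
  where
  c≡1+i*3 : c ≡ suc (i * 3)
  c≡1+i*3 = trans (sym (trans low (down-even c))) eq
... | result c zero refl | inj₂ high = contradiction 0≡1 λ ()
  where
  0≡1 : 0 ≡ 1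
  0≡1 = begin
    0                  ≡⟨ m*n%n≡0 c 3 ⟨
    c * 3 % 3          ≡⟨ cong (_% 3) (trans (sym (trans high (up-even c))) eq) ⟩
    (1 + i * 3) % 3    ≡⟨ [r+q*n]%n≡r 1 i 3 (s≤s (s≤s z≤n)) ⟩
    1                  ∎
... | result c (suc zero) refl | inj₁ low = inj₂ (≤-reflexive (cong (λ x → 1 + x * 2) (sym c≡i*3)))
  where
  c≡i*3 : c ≡ i * 3
  c≡i*3 = suc-injective (trans (sym (trans low (down-odd c))) eq)
... | result c (suc zero) refl | inj₂ high = inj₁ (cong (λ x → 1 + x * 2) c≡i)
  where
  c≡i : c ≡ i
  c≡i = *-cancelʳ-≡ c i 3 (suc-injective (trans (sym (trans high (up-odd c))) eq))

pos-odd-taken : ∀ i → TakenBefore (1 + i * 2) (suc i) → pos (1 + i * 3 * 2) ≡ E (pos (1 + i * 2))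
pos-odd-taken zero taken = contradiction taken ¬TakenBefore-1
pos-odd-taken i@(suc _) taken = begin
  pos (1 + i * 3 * 2)  ≡⟨ pos-taken (down-odd (i * 3)) (1 + i * 2 , s≤s z≤n , M<N , pos-M) ⟩
  up (1 + i * 3 * 2)   ≡⟨ up-odd (i * 3) ⟩
  suc (i * 3 * 3)      ≡⟨ ring i ⟩
  9 * i + 1            ≡⟨ E[1+q*3]≡9q+1 i ⟨
  E (suc (i * 3))      ≡⟨ cong E pos-M ⟨
  E (pos (1 + i * 2))  ∎
  where
  pos-M : pos (1 + i * 2) ≡ suc (i * 3)
  pos-M = trans (pos-taken (down-odd i) taken) (up-odd i)
  M<N : 1 + i * 2 < 1 + i * 3 * 2
  M<N = s≤s (*-monoˡ-< 2 (m<m*n i 3 (s≤s (s≤s z≤n))))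
  ring : ∀ i → suc (i * 3 * 3) ≡ 9 * i + 1
  ring = solve-∀

3∤free-odd-target : ∀ i → ¬ TakenBefore (1 + i * 2) (suc i) → ¬ 3 ∣ suc i
3∤free-odd-target i free (divides (suc q) 1+i≡[1+q]*3) =
  free (suc q * 2 , s≤s z≤n , s≤s (*-monoˡ-≤ 2 1+q≤i) , trans (pos-even q) (sym 1+i≡[1+q]*3))
  where
  1+q≤i : suc q ≤ i
  1+q≤i rewrite suc-injective 1+i≡[1+q]*3 = s≤s (≤-trans (m≤m*n q 3) (n≤1+n _))

pos-odd-free : ∀ i → ¬ TakenBefore (1 + i * 2) (suc i) → pos (1 + i * 3 * 2) ≡ E (pos (1 + i * 2))
pos-odd-free i free = begin
  pos (1 + i * 3 * 2)  ≡⟨ pos-free (down-odd (i * 3)) N-free ⟩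
  suc (i * 3)          ≡⟨ E[1+i]≡1+i*3 i (3∤free-odd-target i free) ⟨
  E (suc i)            ≡⟨ cong E pos-M ⟨
  E (pos (1 + i * 2))  ∎
  where
  pos-M : pos (1 + i * 2) ≡ suc i
  pos-M = pos-free (down-odd i) free
  N-free : ¬ TakenBefore (1 + i * 3 * 2) (suc (i * 3))
  N-free (j , _ , j<N , pos-j) with pos-preimage-1+i*3 {i} j pos-j
  ... | inj₂ N≤j = <⇒≱ j<N N≤j
  ... | inj₁ refl = <-irrefl (cong (λ x → 1 + x * 2) i≡i*3) j<N
    where
    i≡i*3 : i ≡ i * 3
    i≡i*3 = suc-injective (trans (sym pos-M) pos-j)

pos-odd : ∀ i → pos (1 + i * 3 * 2) ≡ E (pos (1 + i * 2))
pos-odd i with takenBefore? (1 + i * 2) (suc i)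
... | yes taken = pos-odd-taken i taken
... | no free = pos-odd-free i free

pos[3m∸2]≡E[pos-m] : ∀ m → 1 ≤ m → pos (3 * m ∸ 2) ≡ E (pos m)
pos[3m∸2]≡E[pos-m] m 1≤m with m divMod 2
... | result (suc k) zero refl = begin
  pos (3 * (suc k * 2) ∸ 2)  ≡⟨ cong (pos ∘ (_∸ 2)) (ring₁ k) ⟩
  pos (suc (1 + k * 3) * 2)  ≡⟨ pos-even (1 + k * 3) ⟩
  suc (1 + k * 3) * 3        ≡⟨ ring₂ k ⟩
  9 * k + 6                  ≡⟨ E[3+q*3]≡9q+6 k ⟨
  E (suc k * 3)              ≡⟨ cong E (pos-even k) ⟨
  E (pos (suc k * 2))        ∎
  where
  ring₁ : ∀ k → 3 * (suc k * 2) ≡ 2 + suc (1 + k * 3) * 2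
  ring₁ = solve-∀
  ring₂ : ∀ k → suc (1 + k * 3) * 3 ≡ 9 * k + 6
  ring₂ = solve-∀
... | result i (suc zero) refl = trans (cong (pos ∘ (_∸ 2)) (ring i)) (pos-odd i)
  where
  ring : ∀ i → 3 * (1 + i * 2) ≡ 2 + (1 + i * 3 * 2)
  ring = solve-∀

theorem3 : ∀ (n m : ℕ) → 1 ≤ n → ΠIs n m → ΠIs (E n) (3 * m ∸ 2)
theorem3 n m _ (1≤m , pos-m , _) =
  1≤3m∸2 , pos-3m∸2 , λ k 3m∸2<k → pos-injective 1≤3m∸2 3m∸2<k ∘ trans pos-3m∸2 ∘ sym
  where
  1≤3m∸2 : 1 ≤ 3 * m ∸ 2
  1≤3m∸2 = ∸-monoˡ-≤ 2 (*-monoʳ-≤ 3 1≤m)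
  pos-3m∸2 : pos (3 * m ∸ 2) ≡ E n
  pos-3m∸2 = trans (pos[3m∸2]≡E[pos-m] m 1≤m) (cong E pos-m)
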